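{- For all terms $r,s$ of Polymorphic System I such that $r\rightleftarrows s$, we have $M(r)=M(s)$.
   Context: Terms: $r ::= x^A \mid \lambda x^A.r \mid rr \mid \langle r,r\rangle \mid \pi_A(r) \mid \Lambda X.r \mid r[A]$, over types $A ::= X \mid A\Rightarrow A \mid A\wedge A \mid \forall X.A$ ($FTV$ free type variables). Term equivalence $\rightleftarrows$: the symmetric relation, closed under all term constructors, generated by: $\langle r,s\rangle\rightleftarrows\langle s,r\rangle$; $\langle r,\langle s,t\rangle\rangle\rightleftarrows\langle\langle r,s\rangle,t\rangle$; $\lambda x^A.\langle r,s\rangle\rightleftarrows\langle\lambda x^A.r,\lambda x^A.s\rangle$; $\langle r,s\rangle t\rightleftarrows\langle rt,st\rangle$; $r\langle s,t\rangle\rightleftarrows (rs)t$; $\Lambda X.\lambda x^A.r\rightleftarrows\lambda x^A.\Lambda X.r$ if $X\notin FTV(A)$; $(\lambda x^A.r)[B]\rightleftarrows\lambda x^A.(r[B])$; $\Lambda X.\langle r,s\rangle\rightleftarrows\langle\Lambda X.r,\Lambda X.s\rangle$; $\langle r,s\rangle[A]\rightleftarrows\langle r[A],s[A]\rangle$; $\pi_{\forall X.A}(\Lambda X.r)\rightleftarrows\Lambda X.\pi_A(r)$; $(\pi_{\forall X.B}(r))[A]\rightleftarrows\pi_{[X:=A]B}(r[A])$ (when $r$ has type $\forall X.(B\wedge C)$). Functions on terms: $P(x)=0$, $P(\lambda x^A.r)=P(r)$, $P(rs)=P(r)$, $P(\langle r,s\rangle)=1+P(r)+P(s)$, $P(\pi_A(r))=P(r)$,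 $P(\Lambda X.r)=P(r)$, $P(r[A])=P(r)$; and $M(x)=1$, $M(\lambda x^A.r)=1+M(r)+P(r)$, $M(rs)=M(r)+M(s)+P(r)M(s)$, $M(\langle r,s\rangle)=M(r)+M(s)$, $M(\pi_A(r))=1+M(r)+P(r)$, $M(\Lambda X.r)=1+M(r)+P(r)$, $M(r[A])=1+M(r)+P(r)$. -}

module Defs where

open import Data.Nat using (ℕ; suc; _+_; _*_; _≟_)
open import Data.List using (List; []; _∷_; _++_; filter)
open import Data.List.Membership.Propositional using (_∉_)
open import Relation.Nullary using (¬?; yes; no)

TyVar : Set
TyVar = ℕ

Var : Set
Var = ℕ

data Ty : Set where
  tvar : TyVar → Ty
  _⇒_  : Ty → Ty → Ty
  _∧_  : Ty → Ty → Ty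
  ∀'   : TyVar → Ty → Ty

FTV : Ty → List TyVar
FTV (tvar X)  = X ∷ []
FTV (A ⇒ B)   = FTV A ++ FTV B
FTV (A ∧ B)   = FTV A ++ FTV B
FTV (∀' X A)  = filter (λ Y → ¬? (Y ≟ X)) (FTV A)

-- type substitution [X := A]B (Barendregt convention: bound variables
-- assumed distinct from free ones, so no renaming is performed)
_[_≔_] : Ty → TyVar → Ty → Ty
tvar Y [ X ≔ A ] with Y ≟ X
... | yes _ = A
... | no  _ = tvar Y
(B ⇒ C) [ X ≔ A ] = (B [ X ≔ A ]) ⇒ (C [ X ≔ A ])
(B ∧ C) [ X ≔ A ] = (B [ X ≔ A ]) ∧ (C [ X ≔ A ])
∀' Y B [ X ≔ A ] with Y ≟ X
... | yes _ = ∀' Y B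
... | no  _ = ∀' Y (B [ X ≔ A ])

data Term : Set where
  var  : Var → Ty → Term
  lam  : Var → Ty → Term → Term
  app  : Term → Term → Term
  pair : Term → Term → Term
  proj : Ty → Term → Term
  tlam : TyVar → Term → Term
  tapp : Term → Ty → Term

P : Term → ℕ
P (var x A)    = 0
P (lam x A r)  = P r
P (app r s)    = P r
P (pair r s)   = 1 + P r + P s
P (proj A r)   = P r
P (tlam X r)   = P r
P (tapp r A)   = P r

M : Term → ℕ
M (var x A)    = 1
M (lam x A r)  = 1 + M r + P r
M (app r s)    = M r + M s + P r * M s
M (pair r s)   = M r + M s
M (proj A r)   = 1 + M r + P r
M (tlam X r)   = 1 + M r + P r
M (tapp r A)   = 1 + M r + P r

-- The relation is
-- parametrised by the typing judgment  HasType r A  ("r has type A"),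
-- which only occurs in the side condition of the last rule.
module Equiv (HasType : Term → Ty → Set) where

  data _↦_ : Term → Term → Set where
    comm     : ∀ r s → pair r s ↦ pair s r
    asso     : ∀ r s t → pair r (pair s t) ↦ pair (pair r s) t
    distλ    : ∀ x A r s → lam x A (pair r s) ↦ pair (lam x A r) (lam x A s)
    distapp  : ∀ r s t → app (pair r s) t ↦ pair (app r t) (app s t)
    curry    : ∀ r s t → app r (pair s t) ↦ app (app r s) t
    PI1      : ∀ X x A r → X ∉ FTV A → tlam X (lam x A r) ↦ lam x A (tlam X r)
    PI2      : ∀ x A r B → tapp (lam x A r) B ↦ lam x A (tapp r B)
    distΛ    : ∀ X r s → tlam X (pair r s) ↦ pair (tlam X r) (tlam X s)
    distapp∀ : ∀ r s A → tapp (pair r s) A ↦ pair (tapp r A) (tapp s A)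
    PI3      : ∀ X A r → proj (∀' X A) (tlam X r) ↦ tlam X (proj A r)
    PI4      : ∀ X B C A r → HasType r (∀' X (B ∧ C)) →
               tapp (proj (∀' X B) r) A ↦ proj (B [ X ≔ A ]) (tapp r A)

  data _⇄_ : Term → Term → Set where
    ax-l   : ∀ {r s} → r ↦ s → r ⇄ s
    ax-r   : ∀ {r s} → s ↦ r → r ⇄ s
    c-lam  : ∀ {r s} x A → r ⇄ s → lam x A r ⇄ lam x A s
    c-appl : ∀ {r s} t → r ⇄ s → app r t ⇄ app s t
    c-appr : ∀ {r s} t → r ⇄ s → app t r ⇄ app t s
    c-pairl : ∀ {r s} t → r ⇄ s → pair r t ⇄ pair s t
    c-pairr : ∀ {r s} t → r ⇄ s → pair t r ⇄ pair t s
    c-proj : ∀ {r s} A → r ⇄ s → proj A r ⇄ proj A s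
    c-tlam : ∀ {r s} X → r ⇄ s → tlam X r ⇄ tlam X s
    c-tapp : ∀ {r s} A → r ⇄ s → tapp r A ⇄ tapp s A

-- P counts pairing constructors, and every generating rule of ⇄ merely
-- redistributes them, so P is an invariant.  M weights each unary
-- constructor by 1 + P of its body and each application r s by
-- (1 + P r) · M s; with P invariant, the rules that push a pair through a
-- constructor become distributivity identities of ℕ, and the others hold
-- by associativity and commutativity of +.
module Submission where

open import Defs
open import Data.Nat using (ℕ; suc; _+_; _*_)
open import Data.Nat.Properties using (+-comm; +-assoc)
open import Data.Nat.Tactic.RingSolver using (solve-∀)
open import Relation.Binary.PropositionalEquality
  using (_≡_; refl; sym; cong; cong₂)

+-assoc-suc : ∀ a b c → suc (a + suc (b + c)) ≡ suc (suc (a + b) + c)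
+-assoc-suc = solve-∀

suc-+-distrib-pair : ∀ a b p q → suc (a + b + suc (p + q)) ≡ suc (a + p) + suc (b + q)
suc-+-distrib-pair = solve-∀

app-distrib-pairˡ : ∀ a b c p q →
  a + b + c + suc (p + q) * c ≡ a + c + p * c + (b + c + q * c)
app-distrib-pairˡ = solve-∀

app-distrib-pairʳ : ∀ a b c p →
  a + (b + c) + p * (b + c) ≡ a + b + p * b + c + p * c
app-distrib-pairʳ = solve-∀

module _ (HasType : Term → Ty → Set) where
  open Equiv HasType

  P-↦ : ∀ {r s} → r ↦ s → P r ≡ P s
  P-↦ (comm r s)            = cong suc (+-comm (P r) (P s))
  P-↦ (asso r s t)          = +-assoc-suc (P r) (P s) (P t)
  P-↦ (distλ x A r s)       = refl
  P-↦ (distapp r s t)       = refl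
  P-↦ (curry r s t)         = refl
  P-↦ (PI1 X x A r X∉A)     = refl
  P-↦ (PI2 x A r B)         = refl
  P-↦ (distΛ X r s)         = refl
  P-↦ (distapp∀ r s A)      = refl
  P-↦ (PI3 X A r)           = refl
  P-↦ (PI4 X B C A r r:∀BC) = refl

  P-⇄ : ∀ {r s} → r ⇄ s → P r ≡ P s
  P-⇄ (ax-l r↦s)    = P-↦ r↦s
  P-⇄ (ax-r s↦r)    = sym (P-↦ s↦r)
  P-⇄ (c-lam x A e) = P-⇄ e
  P-⇄ (c-appl t e)  = P-⇄ e
  P-⇄ (c-appr t e)  = refl
  P-⇄ (c-pairl t e) = cong (λ p → suc (p + P t)) (P-⇄ e)
  P-⇄ (c-pairr t e) = cong (λ p → suc (P t + p)) (P-⇄ e)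
  P-⇄ (c-proj A e)  = P-⇄ e
  P-⇄ (c-tlam X e)  = P-⇄ e
  P-⇄ (c-tapp A e)  = P-⇄ e

  M-↦ : ∀ {r s} → r ↦ s → M r ≡ M s
  M-↦ (comm r s)            = +-comm (M r) (M s)
  M-↦ (asso r s t)          = sym (+-assoc (M r) (M s) (M t))
  M-↦ (distλ x A r s)       = suc-+-distrib-pair (M r) (M s) (P r) (P s)
  M-↦ (distapp r s t)       = app-distrib-pairˡ (M r) (M s) (M t) (P r) (P s)
  M-↦ (curry r s t)         = app-distrib-pairʳ (M r) (M s) (M t) (P r)
  M-↦ (PI1 X x A r X∉A)     = refl
  M-↦ (PI2 x A r B)         = refl
  M-↦ (distΛ X r s)         = suc-+-distrib-pair (M r) (M s) (P r) (P s)
  M-↦ (distapp∀ r s A)      = suc-+-distrib-pair (M r) (M s) (P r) (P s)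
  M-↦ (PI3 X A r)           = refl
  M-↦ (PI4 X B C A r r:∀BC) = refl

  M-⇄ : ∀ {r s} → r ⇄ s → M r ≡ M s
  M-unary : ∀ {r s} → r ⇄ s → suc (M r + P r) ≡ suc (M s + P s)

  M-⇄ (ax-l r↦s)    = M-↦ r↦s
  M-⇄ (ax-r s↦r)    = sym (M-↦ s↦r)
  M-⇄ (c-lam x A e) = M-unary e
  M-⇄ (c-appl t e)  = cong₂ (λ m p → m + M t + p * M t) (M-⇄ e) (P-⇄ e)
  M-⇄ (c-appr t e)  = cong (λ m → M t + m + P t * m) (M-⇄ e)
  M-⇄ (c-pairl t e) = cong (_+ M t) (M-⇄ e)
  M-⇄ (c-pairr t e) = cong (M t +_) (M-⇄ e)
  M-⇄ (c-proj A e)  = M-unary e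
  M-⇄ (c-tlam X e)  = M-unary e
  M-⇄ (c-tapp A e)  = M-unary e

  M-unary e = cong₂ (λ m p → suc (m + p)) (M-⇄ e) (P-⇄ e)

mainTheorem13 : (HasType : Term → Ty → Set) → (r s : Term) →
    Equiv._⇄_ HasType r s → M r ≡ M s
mainTheorem13 HasType r s = M-⇄ HasType
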